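{- Let $P\subset\mathbb{R}^2$ be a lattice polygon and suppose that $\Delta_P(x)=\Delta_P(y)=l$. Then ${\rm ls}_\square(P)=l$ and $\operatorname{w}(P)=\min\{l,\Delta_P(x+y),\Delta_P(x-y)\}$.
   Context: A lattice polygon is the convex hull of finitely many points of $\mathbb{Z}^2$. For a linear function $f(x,y)=ax+by$ with $a,b\in\mathbb{Z}$, $\Delta_P(f)=\max_{p\in P}f(p)-\min_{p\in P}f(p)$; for primitive $(a,b)$ (i.e. $\gcd(a,b)=1$) this is the lattice width of $P$ in direction $(a,b)$, and the lattice width $\operatorname{w}(P)$ is the minimum of these over all primitive directions. An affine unimodular transformation is a map $T(p)=Ap+v$ with $A$ an integer matrix with $\det A=\pm1$ and $v\in\mathbb{Z}^2$. The lattice size ${\rm ls}_\square(P)$ is the smallest integer $l$ such that $T(P)\subseteq[0,l]^2$ for some affine unimodular transformation $T$. -}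

module Defs where

open import Data.Integer using (ℤ; +_; _+_; _-_; _*_; -_; _⊔_; _⊓_; _≤_; 0ℤ; 1ℤ)
open import Data.Integer.GCD using (gcd)
open import Data.List using (List; foldr)
open import Data.List.NonEmpty using (List⁺; _∷_)
open import Data.List.Membership.Propositional using (_∈_)
open import Data.Product using (_×_; _,_; Σ; ∃)
open import Data.Sum using (_⊎_)
open import Relation.Binary.PropositionalEquality using (_≡_)

Point : Set
Point = ℤ × ℤ

-- A lattice polygon P = conv(S) is represented by a nonempty finite list S of
-- lattice points (its generating set); P is the convex hull of S.
LatticePolygon : Set
LatticePolygon = List⁺ Point

_∈⁺_ : Point → LatticePolygon → Set
p ∈⁺ (q ∷ qs) = p ≡ q ⊎ p ∈ qs

lin : ℤ → ℤ → Point → ℤ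
lin a b (x , y) = a * x + b * y

-- max / min of f over P.  A linear function attains its max/min over conv(S)
-- at a point of S, so these are max_{p∈P} f(p) and min_{p∈P} f(p).
maxOn : (Point → ℤ) → LatticePolygon → ℤ
maxOn f (q ∷ qs) = foldr (λ p m → f p ⊔ m) (f q) qs

minOn : (Point → ℤ) → LatticePolygon → ℤ
minOn f (q ∷ qs) = foldr (λ p m → f p ⊓ m) (f q) qs

Δ : LatticePolygon → ℤ → ℤ → ℤ
Δ P a b = maxOn (lin a b) P - minOn (lin a b) P

Primitive : ℤ → ℤ → Set
Primitive a b = gcd a b ≡ 1ℤ

IsLatticeWidth : LatticePolygon → ℤ → Set
IsLatticeWidth P m =
  (Σ ℤ λ a → Σ ℤ λ b → Primitive a b × Δ P a b ≡ m) ×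
  (∀ a b → Primitive a b → m ≤ Δ P a b)

record AffUnimod : Set where
  constructor affUnimod
  field
    a b c d v₁ v₂ : ℤ
    unimod : (a * d - b * c ≡ 1ℤ) ⊎ (a * d - b * c ≡ - 1ℤ)

apply : AffUnimod → Point → Point
apply T (x , y) = (a * x + b * y + v₁) , (c * x + d * y + v₂)
  where open AffUnimod T

-- T(P) ⊆ [0,l]².  Since T is affine and the square is convex, this holds for
-- P = conv(S) iff it holds for every point of S.
InSquare : ℤ → Point → Set
InSquare l (x , y) = (0ℤ ≤ x × x ≤ l) × (0ℤ ≤ y × y ≤ l)

MapsIntoSquare : AffUnimod → LatticePolygon → ℤ → Set
MapsIntoSquare T P l = ∀ p → p ∈⁺ P → InSquare l (apply T p)

IsLatticeSize : LatticePolygon → ℤ → Set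
IsLatticeSize P l =
  (Σ AffUnimod λ T → MapsIntoSquare T P l) ×
  (∀ (k : ℤ) (T : AffUnimod) → MapsIntoSquare T P k → l ≤ k)

module Submission where

-- Write l = Δ_P(x) = Δ_P(y) and choose generators p, q of P
-- realising the x-extent, so p - q = (l, t) with |t| ≤ Δ_P(y) = l.  For a direction (a,b)
-- with |b| < |a| the value of ax + by on p - q is al + bt, and
-- |al + bt| ≥ |a|l - |b|l ≥ l; symmetrically when |a| < |b|.  Hence every
-- direction with |a| ≠ |b| has Δ_P(a,b) ≥ l ("off-diagonal bound").
--   * Width: a primitive direction with |a| = |b| is (±1,±1), whose width is
--     Δ_P(x+y) or Δ_P(x-y); all others are ≥ l by the bound, and the three
--     candidates are attained by (1,0), (1,1), (1,-1).
--   * Lattice size: translating P into [0,l]² shows ls ≤ l.  If T(P) ⊆ [0,k]²,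
--     each row (a,b) of the matrix of T gives Δ_P(a,b) ≤ k; a unimodular
--     matrix cannot have |a| = |b| in both rows (the determinant would be
--     even), so one row obeys the off-diagonal bound and l ≤ k.

open import Defs
open import Data.Integer
  using (ℤ; +_; -[1+_]; _+_; _-_; _*_; -_; _⊓_; _⊔_; _≤_; ∣_∣; +≤+; 0ℤ; 1ℤ)
open import Data.Integer.Properties
open import Data.Integer.Tactic.RingSolver using (solve-∀)
import Data.Nat as ℕ
import Data.Nat.Properties as ℕ
import Data.Nat.Divisibility as ℕ
import Data.Nat.GCD as ℕ
open import Data.Nat using (ℕ; zero; suc)
open import Data.List using (List; []; _∷_; foldr)
open import Data.List.NonEmpty using (_∷_)
open import Data.List.Membership.Propositional using (_∈_)
open import Data.List.Relation.Unary.Any using (here; there)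
open import Data.Product using (Σ; _×_; _,_; proj₁; proj₂)
open import Data.Sum using (_⊎_; inj₁; inj₂) renaming (map to ⊎-map)
open import Data.Empty using (⊥; ⊥-elim)
open import Relation.Nullary using (¬_; yes; no; Dec)
open import Relation.Binary.Definitions using (tri<; tri≈; tri>)
open import Relation.Binary.PropositionalEquality
  using (_≡_; refl; sym; trans; cong; cong₂; subst; subst₂; module ≡-Reasoning)

module Folds (f : Point → ℤ) where

  fmax : ℤ → List Point → ℤ
  fmax b qs = foldr (λ p m → f p ⊔ m) b qs

  fmin : ℤ → List Point → ℤ
  fmin b qs = foldr (λ p m → f p ⊓ m) b qs

  fmax-start : ∀ b qs → b ≤ fmax b qs
  fmax-start b []       = ≤-refl
  fmax-start b (p ∷ qs) = ≤-trans (fmax-start b qs) (i≤j⊔i (f p) (fmax b qs))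

  fmax-member : ∀ b qs p → p ∈ qs → f p ≤ fmax b qs
  fmax-member b (q ∷ qs) p (here refl) = i≤i⊔j (f p) (fmax b qs)
  fmax-member b (q ∷ qs) p (there m)   =
    ≤-trans (fmax-member b qs p m) (i≤j⊔i (f q) (fmax b qs))

  fmin-start : ∀ b qs → fmin b qs ≤ b
  fmin-start b []       = ≤-refl
  fmin-start b (p ∷ qs) = ≤-trans (i⊓j≤j (f p) (fmin b qs)) (fmin-start b qs)

  fmin-member : ∀ b qs p → p ∈ qs → fmin b qs ≤ f p
  fmin-member b (q ∷ qs) p (here refl) = i⊓j≤i (f p) (fmin b qs)
  fmin-member b (q ∷ qs) p (there m)   =
    ≤-trans (i⊓j≤j (f q) (fmin b qs)) (fmin-member b qs p m)

  fmax-attained : ∀ b qs → fmax b qs ≡ b ⊎ Σ Point λ p → p ∈ qs × fmax b qs ≡ f p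
  fmax-attained b [] = inj₁ refl
  fmax-attained b (q ∷ qs) with ⊔-sel (f q) (fmax b qs)
  ... | inj₁ e = inj₂ (q , here refl , e)
  ... | inj₂ e with fmax-attained b qs
  ...   | inj₁ e'           = inj₁ (trans e e')
  ...   | inj₂ (p , m , e') = inj₂ (p , there m , trans e e')

  fmin-attained : ∀ b qs → fmin b qs ≡ b ⊎ Σ Point λ p → p ∈ qs × fmin b qs ≡ f p
  fmin-attained b [] = inj₁ refl
  fmin-attained b (q ∷ qs) with ⊓-sel (f q) (fmin b qs)
  ... | inj₁ e = inj₂ (q , here refl , e)
  ... | inj₂ e with fmin-attained b qs
  ...   | inj₁ e'           = inj₁ (trans e e')
  ...   | inj₂ (p , m , e') = inj₂ (p , there m , trans e e')

open Folds

maxOn-upper : ∀ f P p → p ∈⁺ P → f p ≤ maxOn f P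
maxOn-upper f (q ∷ qs) p (inj₁ refl) = fmax-start f (f q) qs
maxOn-upper f (q ∷ qs) p (inj₂ m)    = fmax-member f (f q) qs p m

maxOn-attained : ∀ f P → Σ Point λ p → p ∈⁺ P × maxOn f P ≡ f p
maxOn-attained f (q ∷ qs) with fmax-attained f (f q) qs
... | inj₁ e           = q , inj₁ refl , e
... | inj₂ (p , m , e) = p , inj₂ m , e

minOn-lower : ∀ f P p → p ∈⁺ P → minOn f P ≤ f p
minOn-lower f (q ∷ qs) p (inj₁ refl) = fmin-start f (f q) qs
minOn-lower f (q ∷ qs) p (inj₂ m)    = fmin-member f (f q) qs p m

minOn-attained : ∀ f P → Σ Point λ p → p ∈⁺ P × minOn f P ≡ f p
minOn-attained f (q ∷ qs) with fmin-attained f (f q) qs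
... | inj₁ e           = q , inj₁ refl , e
... | inj₂ (p , m , e) = p , inj₂ m , e

Δ-upper : ∀ P a b {p q} → p ∈⁺ P → q ∈⁺ P → lin a b p - lin a b q ≤ Δ P a b
Δ-upper P a b {p} {q} p∈P q∈P =
  +-mono-≤ (maxOn-upper (lin a b) P p p∈P) (neg-mono-≤ (minOn-lower (lin a b) P q q∈P))

Δ-attained : ∀ P a b →
  Σ Point λ p → Σ Point λ q → p ∈⁺ P × q ∈⁺ P × Δ P a b ≡ lin a b p - lin a b q
Δ-attained P a b with maxOn-attained (lin a b) P | minOn-attained (lin a b) P
... | p , p∈P , e | q , q∈P , e' = p , q , p∈P , q∈P , cong₂ _-_ e e'

abs-≤ : ∀ {x D} → x ≤ D → - x ≤ D → + ∣ x ∣ ≤ D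
abs-≤ {+ n}      x≤D _  = x≤D
abs-≤ { -[1+ n ]} _ -x≤D = -x≤D

Δ-abs : ∀ P a b {p q} → p ∈⁺ P → q ∈⁺ P → + ∣ lin a b p - lin a b q ∣ ≤ Δ P a b
Δ-abs P a b {p} {q} p∈P q∈P =
  abs-≤ (Δ-upper P a b p∈P q∈P)
        (subst (_≤ Δ P a b) (sym (neg-minus (lin a b p) (lin a b q)))
               (Δ-upper P a b q∈P p∈P))
  where
  neg-minus : ∀ u v → - (u - v) ≡ v - u
  neg-minus = solve-∀

Δ-nonneg : ∀ P a b → 0ℤ ≤ Δ P a b
Δ-nonneg (q ∷ qs) a b =
  subst (_≤ Δ (q ∷ qs) a b) (+-inverseʳ (lin a b q)) (Δ-upper (q ∷ qs) a b (inj₁ refl) (inj₁ refl))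

Δ-negate : ∀ P a b → Δ P a b ≤ Δ P (- a) (- b)
Δ-negate P a b with Δ-attained P a b
... | (x , y) , (x' , y') , p∈P , q∈P , e =
  subst (_≤ Δ P (- a) (- b)) (trans (swap a b x y x' y') (sym e)) (Δ-upper P (- a) (- b) q∈P p∈P)
  where
  swap : ∀ a b x y x' y' →
    (- a * x' + - b * y') - (- a * x + - b * y) ≡ (a * x + b * y) - (a * x' + b * y')
  swap = solve-∀

Δ-strip : ∀ P a b v k → (∀ p → p ∈⁺ P → (0ℤ ≤ lin a b p + v) × (lin a b p + v ≤ k)) → Δ P a b ≤ k
Δ-strip P a b v k inStrip with Δ-attained P a b
... | p , q , p∈P , q∈P , e =
  subst (_≤ k) (sym (trans e (shift (lin a b p) (lin a b q) v)))
    (subst (_ ≤_) (+-identityʳ k)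
      (+-mono-≤ (proj₂ (inStrip p p∈P)) (neg-mono-≤ (proj₁ (inStrip q q∈P)))))
  where
  shift : ∀ u w v → u - w ≡ (u + v) - (w + v)
  shift = solve-∀

diagonal-width : ∀ P a b → a ≡ 1ℤ ⊎ a ≡ - 1ℤ → b ≡ 1ℤ ⊎ b ≡ - 1ℤ →
  Δ P 1ℤ 1ℤ ⊓ Δ P 1ℤ (- 1ℤ) ≤ Δ P a b
diagonal-width P _ _ (inj₁ refl) (inj₁ refl) = i⊓j≤i _ _
diagonal-width P _ _ (inj₁ refl) (inj₂ refl) = i⊓j≤j _ _
diagonal-width P _ _ (inj₂ refl) (inj₂ refl) = ≤-trans (i⊓j≤i _ _) (Δ-negate P 1ℤ 1ℤ)
diagonal-width P _ _ (inj₂ refl) (inj₁ refl) = ≤-trans (i⊓j≤j _ _) (Δ-negate P 1ℤ (- 1ℤ))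

lin-difference : ∀ a b x y x' y' → lin a b (x , y) - lin a b (x' , y') ≡ a * (x - x') + b * (y - y')
lin-difference = expand
  where expand : ∀ a b x y x' y' → (a * x + b * y) - (a * x' + b * y') ≡ a * (x - x') + b * (y - y')
        expand = solve-∀

x-difference : ∀ x y x' y' → lin 1ℤ 0ℤ (x , y) - lin 1ℤ 0ℤ (x' , y') ≡ x - x'
x-difference = expand
  where expand : ∀ x y x' y' → (1ℤ * x + 0ℤ * y) - (1ℤ * x' + 0ℤ * y') ≡ x - x'
        expand = solve-∀

y-difference : ∀ x y x' y' → lin 0ℤ 1ℤ (x , y) - lin 0ℤ 1ℤ (x' , y') ≡ y - y'
y-difference = expand
  where expand : ∀ x y x' y' → (0ℤ * x + 1ℤ * y) - (0ℤ * x' + 1ℤ * y') ≡ y - y'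
        expand = solve-∀

-- The dominant coefficient wins: if |b| < |a| and |t| ≤ L then L ≤ |aL + bt|,
-- since |a|L ≤ |aL + bt| + |b||t| ≤ |aL + bt| + |b|L and (1 + |b|)L ≤ |a|L.
dominant-term : ∀ a b t L → ∣ b ∣ ℕ.< ∣ a ∣ → ∣ t ∣ ℕ.≤ L → L ℕ.≤ ∣ a * + L + b * t ∣
dominant-term a b t L |b|<|a| |t|≤L =
  ℕ.+-cancelʳ-≤ (∣ b ∣ ℕ.* L) L ∣ X ∣ (ℕ.≤-trans (ℕ.*-monoˡ-≤ L |b|<|a|) aL≤)
  where
  X = a * + L + b * t
  split : ∀ a b t l → a * l ≡ (a * l + b * t) - b * t
  split = solve-∀
  open ℕ.≤-Reasoning
  aL≤ : ∣ a ∣ ℕ.* L ℕ.≤ ∣ X ∣ ℕ.+ ∣ b ∣ ℕ.* L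
  aL≤ = begin
    ∣ a ∣ ℕ.* L              ≡⟨ sym (abs-* a (+ L)) ⟩
    ∣ a * + L ∣              ≡⟨ cong ∣_∣ (split a b t (+ L)) ⟩
    ∣ X - b * t ∣            ≤⟨ ∣i-j∣≤∣i∣+∣j∣ X (b * t) ⟩
    ∣ X ∣ ℕ.+ ∣ b * t ∣      ≡⟨ cong (∣ X ∣ ℕ.+_) (abs-* b t) ⟩
    ∣ X ∣ ℕ.+ ∣ b ∣ ℕ.* ∣ t ∣ ≤⟨ ℕ.+-monoʳ-≤ ∣ X ∣ (ℕ.*-monoʳ-≤ ∣ b ∣ |t|≤L) ⟩
    ∣ X ∣ ℕ.+ ∣ b ∣ ℕ.* L    ∎

abs-injective : ∀ i j → ∣ i ∣ ≡ ∣ j ∣ → j ≡ i ⊎ j ≡ - i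
abs-injective (+ m)      (+ .m)       refl = inj₁ refl
abs-injective (+ zero)   -[1+ n ]     ()
abs-injective (+ suc m)  -[1+ .m ]    refl = inj₂ refl
abs-injective -[1+ m ]   -[1+ .m ]    refl = inj₁ refl
abs-injective -[1+ m ]   (+ zero)     ()
abs-injective -[1+ m ]   (+ suc .m)   refl = inj₂ refl

even-not-unit : ∀ z → ¬ (z + z ≡ 1ℤ ⊎ z + z ≡ - 1ℤ)
even-not-unit (+ zero)  (inj₁ ())
even-not-unit (+ zero)  (inj₂ ())
even-not-unit (+ suc n) (inj₁ e) rewrite ℕ.+-suc n n with e
... | ()
even-not-unit (+ suc n) (inj₂ ())
even-not-unit -[1+ n ]  (inj₁ ())
even-not-unit -[1+ n ]  (inj₂ ())

diagonal-rows-even : ∀ a b c d → b ≡ a ⊎ b ≡ - a → d ≡ c ⊎ d ≡ - c →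
  Σ ℤ λ z → a * d - b * c ≡ z + z
diagonal-rows-even a _ c _ (inj₁ refl) (inj₁ refl) = 0ℤ , e a c
  where e : ∀ a c → a * c - a * c ≡ 0ℤ + 0ℤ
        e = solve-∀
diagonal-rows-even a _ c _ (inj₁ refl) (inj₂ refl) = - (a * c) , e a c
  where e : ∀ a c → a * (- c) - a * c ≡ - (a * c) + - (a * c)
        e = solve-∀
diagonal-rows-even a _ c _ (inj₂ refl) (inj₁ refl) = a * c , e a c
  where e : ∀ a c → a * c - (- a) * c ≡ a * c + a * c
        e = solve-∀
diagonal-rows-even a _ c _ (inj₂ refl) (inj₂ refl) = 0ℤ , e a c
  where e : ∀ a c → a * (- c) - (- a) * c ≡ 0ℤ + 0ℤ
        e = solve-∀

unimodular-off-diagonal-row : ∀ a b c d → (a * d - b * c ≡ 1ℤ) ⊎ (a * d - b * c ≡ - 1ℤ) →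
  ¬ (∣ a ∣ ≡ ∣ b ∣ × ∣ c ∣ ≡ ∣ d ∣)
unimodular-off-diagonal-row a b c d unit (ab , cd)
  with diagonal-rows-even a b c d (abs-injective a b ab) (abs-injective c d cd)
... | z , e = even-not-unit z (⊎-map (trans (sym e)) (trans (sym e)) unit)

sign : ∀ z → ∣ z ∣ ≡ 1 → z ≡ 1ℤ ⊎ z ≡ - 1ℤ
sign (+ .1)       refl = inj₁ refl
sign -[1+ zero ]  refl = inj₂ refl

primitive-diagonal : ∀ a b → Primitive a b → ∣ a ∣ ≡ ∣ b ∣ →
  (a ≡ 1ℤ ⊎ a ≡ - 1ℤ) × (b ≡ 1ℤ ⊎ b ≡ - 1ℤ)
primitive-diagonal a b prim ab = sign a |a|≡1 , sign b (trans (sym ab) |a|≡1)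
  where
  |a|∣1 : ∣ a ∣ ℕ.∣ 1
  |a|∣1 = subst (∣ a ∣ ℕ.∣_) (+-injective prim)
            (ℕ.gcd-greatest (ℕ.∣-refl {∣ a ∣}) (subst (∣ a ∣ ℕ.∣_) ab (ℕ.∣-refl {∣ a ∣})))
  |a|≡1 : ∣ a ∣ ≡ 1
  |a|≡1 = ℕ.∣1⇒≡1 |a|∣1

module EqualAxisWidths (P : LatticePolygon) (L : ℕ)
                       (Δx≡L : Δ P 1ℤ 0ℤ ≡ + L) (Δy≡L : Δ P 0ℤ 1ℤ ≡ + L) where

  extent-bound : ∀ a b {p q} → p ∈⁺ P → q ∈⁺ P → ∀ a' b' t →
    lin a b p - lin a b q ≡ a' * + L + b' * t → ∣ b' ∣ ℕ.< ∣ a' ∣ → ∣ t ∣ ℕ.≤ L →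
    + L ≤ Δ P a b
  extent-bound a b p∈P q∈P a' b' t e |b'|<|a'| |t|≤L =
    ≤-trans (+≤+ (dominant-term a' b' t L |b'|<|a'| |t|≤L))
            (subst (λ z → + ∣ z ∣ ≤ Δ P a b) e (Δ-abs P a b p∈P q∈P))

  Δx-bound : ∀ {x y x' y'} → (x , y) ∈⁺ P → (x' , y') ∈⁺ P → ∣ x - x' ∣ ℕ.≤ L
  Δx-bound {x} {y} {x'} {y'} p∈P q∈P =
    drop‿+≤+ (subst₂ (λ d D → + ∣ d ∣ ≤ D) (x-difference x y x' y') Δx≡L (Δ-abs P 1ℤ 0ℤ p∈P q∈P))

  Δy-bound : ∀ {x y x' y'} → (x , y) ∈⁺ P → (x' , y') ∈⁺ P → ∣ y - y' ∣ ℕ.≤ L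
  Δy-bound {x} {y} {x'} {y'} p∈P q∈P =
    drop‿+≤+ (subst₂ (λ d D → + ∣ d ∣ ≤ D) (y-difference x y x' y') Δy≡L (Δ-abs P 0ℤ 1ℤ p∈P q∈P))

  -- Off-diagonal bound for |b| < |a|: the generators realising Δ_P(x) differ by (L, t).
  x-dominant : ∀ a b → ∣ b ∣ ℕ.< ∣ a ∣ → + L ≤ Δ P a b
  x-dominant a b |b|<|a| with Δ-attained P 1ℤ 0ℤ
  ... | (x , y) , (x' , y') , p∈P , q∈P , e =
    extent-bound a b p∈P q∈P a b (y - y') diff |b|<|a| (Δy-bound p∈P q∈P)
    where
    x-x'≡L : x - x' ≡ + L
    x-x'≡L = trans (sym (x-difference x y x' y')) (trans (sym e) Δx≡L)
    open ≡-Reasoning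
    diff : lin a b (x , y) - lin a b (x' , y') ≡ a * + L + b * (y - y')
    diff = begin
      lin a b (x , y) - lin a b (x' , y') ≡⟨ lin-difference a b x y x' y' ⟩
      a * (x - x') + b * (y - y')         ≡⟨ cong (λ s → a * s + b * (y - y')) x-x'≡L ⟩
      a * + L + b * (y - y')              ∎

  -- Off-diagonal bound for |a| < |b|: the generators realising Δ_P(y) differ by (s, L).
  y-dominant : ∀ a b → ∣ a ∣ ℕ.< ∣ b ∣ → + L ≤ Δ P a b
  y-dominant a b |a|<|b| with Δ-attained P 0ℤ 1ℤ
  ... | (x , y) , (x' , y') , p∈P , q∈P , e =
    extent-bound a b p∈P q∈P b a (x - x') diff |a|<|b| (Δx-bound p∈P q∈P)
    where
    y-y'≡L : y - y' ≡ + L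
    y-y'≡L = trans (sym (y-difference x y x' y')) (trans (sym e) Δy≡L)
    open ≡-Reasoning
    diff : lin a b (x , y) - lin a b (x' , y') ≡ b * + L + a * (x - x')
    diff = begin
      lin a b (x , y) - lin a b (x' , y') ≡⟨ lin-difference a b x y x' y' ⟩
      a * (x - x') + b * (y - y')         ≡⟨ +-comm (a * (x - x')) (b * (y - y')) ⟩
      b * (y - y') + a * (x - x')         ≡⟨ cong (λ s → b * s + a * (x - x')) y-y'≡L ⟩
      b * + L + a * (x - x')              ∎

  off-diagonal : ∀ a b → ¬ (∣ a ∣ ≡ ∣ b ∣) → + L ≤ Δ P a b
  off-diagonal a b |a|≢|b| with ℕ.<-cmp ∣ a ∣ ∣ b ∣
  ... | tri< |a|<|b| _ _ = y-dominant a b |a|<|b|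
  ... | tri≈ _ |a|≡|b| _ = ⊥-elim (|a|≢|b| |a|≡|b|)
  ... | tri> _ _ |b|<|a| = x-dominant a b |b|<|a|

  width : ℤ
  width = + L ⊓ (Δ P 1ℤ 1ℤ ⊓ Δ P 1ℤ (- 1ℤ))

  width-lower : ∀ a b → Primitive a b → width ≤ Δ P a b
  width-lower a b prim = by-cases (∣ a ∣ ℕ.≟ ∣ b ∣)
    where
    -- (a plain case split, since `with` would also abstract inside `prim`)
    by-cases : Dec (∣ a ∣ ≡ ∣ b ∣) → width ≤ Δ P a b
    by-cases (no |a|≢|b|) = ≤-trans (i⊓j≤i (+ L) _) (off-diagonal a b |a|≢|b|)
    by-cases (yes |a|≡|b|) =
      ≤-trans (i⊓j≤j (+ L) _) (diagonal-width P a b (proj₁ units) (proj₂ units))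
      where units = primitive-diagonal a b prim |a|≡|b|

  width-attained : Σ ℤ λ a → Σ ℤ λ b → Primitive a b × Δ P a b ≡ width
  width-attained with ⊓-sel (+ L) (Δ P 1ℤ 1ℤ ⊓ Δ P 1ℤ (- 1ℤ))
  ... | inj₁ e = 1ℤ , 0ℤ , refl , trans Δx≡L (sym e)
  ... | inj₂ e with ⊓-sel (Δ P 1ℤ 1ℤ) (Δ P 1ℤ (- 1ℤ))
  ...   | inj₁ e' = 1ℤ , 1ℤ , refl , sym (trans e e')
  ...   | inj₂ e' = 1ℤ , - 1ℤ , refl , sym (trans e e')

  translation : AffUnimod
  translation = affUnimod 1ℤ 0ℤ 0ℤ 1ℤ (- minOn (lin 1ℤ 0ℤ) P) (- minOn (lin 0ℤ 1ℤ) P) (inj₁ refl)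

  translated-into : ∀ f p → p ∈⁺ P → maxOn f P - minOn f P ≡ + L →
    (0ℤ ≤ f p - minOn f P) × (f p - minOn f P ≤ + L)
  translated-into f p p∈P extent =
    i≤j⇒0≤j-i (minOn-lower f P p p∈P) ,
    subst (f p - minOn f P ≤_) extent (+-monoˡ-≤ (- minOn f P) (maxOn-upper f P p p∈P))

  translation-fits : MapsIntoSquare translation P (+ L)
  translation-fits p p∈P =
    translated-into (lin 1ℤ 0ℤ) p p∈P Δx≡L , translated-into (lin 0ℤ 1ℤ) p p∈P Δy≡L

  -- Lattice size, lower bound: some row of T is off-diagonal and its strip has width ≤ k.
  size-lower : ∀ k T → MapsIntoSquare T P k → + L ≤ k
  size-lower k (affUnimod a b c d v₁ v₂ unit) fits with ∣ a ∣ ℕ.≟ ∣ b ∣ | ∣ c ∣ ℕ.≟ ∣ d ∣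
  ... | no |a|≢|b| | _ =
    ≤-trans (off-diagonal a b |a|≢|b|) (Δ-strip P a b v₁ k (λ { (x , y) p∈P → proj₁ (fits (x , y) p∈P) }))
  ... | yes _ | no |c|≢|d| =
    ≤-trans (off-diagonal c d |c|≢|d|) (Δ-strip P c d v₂ k (λ { (x , y) p∈P → proj₂ (fits (x , y) p∈P) }))
  ... | yes |a|≡|b| | yes |c|≡|d| =
    ⊥-elim (unimodular-off-diagonal-row a b c d unit (|a|≡|b| , |c|≡|d|))
mainTheorem2 : (P : LatticePolygon) (l : ℤ) →
    Δ P 1ℤ 0ℤ ≡ l → Δ P 0ℤ 1ℤ ≡ l →
    IsLatticeSize P l × IsLatticeWidth P (l ⊓ (Δ P 1ℤ 1ℤ ⊓ Δ P 1ℤ (- 1ℤ)))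
mainTheorem2 P (+ L) Δx≡L Δy≡L =
  ((translation , translation-fits) , size-lower) , (width-attained , width-lower)
  where open EqualAxisWidths P L Δx≡L Δy≡L
mainTheorem2 P -[1+ n ] Δx≡l _ with subst (0ℤ ≤_) Δx≡l (Δ-nonneg P 1ℤ 0ℤ)
... | ()
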